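{- Let $F:\mathbf{Set}\to\mathbf{Set}$ be a covariant endofunctor and let $(G_i=(V_i,E_i,g_i))_{i\in I}$ be a family of $F$-graphs. Let $\alpha=\prod_i g_i:\prod_i E_i\to\prod_i FV_i$, and let $\beta:F(\prod_i V_i)\to\prod_i FV_i$ be the canonical map with components $F(\pi_i^V)$, where $\pi_i^V:\prod_j V_j\to V_i$ are the projections. Form the pullback in $\mathbf{Set}$ $$E_{prod}\xrightarrow{\ \mathrm{pb}(\alpha)\ }F\Big(\prod_i V_i\Big),\qquad E_{prod}\xrightarrow{\ \mathrm{pb}(\beta)\ }\prod_i E_i,\qquad \beta\circ\mathrm{pb}(\alpha)=\alpha\circ\mathrm{pb}(\beta).$$ Then the product of the family $(G_i)_{i\in I}$ in the category of $F$-graphs is $\prod_i G_i=(\prod_i V_i,\ E_{prod},\ \mathrm{pb}(\alpha))$, with projection homomorphisms $\pi_i=(\pi_i^V,\ \pi_i^E\circ\mathrm{pb}(\beta)):\prod_i G_i\to G_i$, where $\pi_i^E:\prod_j E_j\to E_i$ are the projections.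
   Context: For a covariant endofunctor $F$ on $\mathbf{Set}$, an $F$-graph is a triple $G=(V,E,g)$ with sets $V$ (vertices), $E$ (edges) and a map $g:E\to FV$. A homomorphism $(V_1,E_1,g_1)\to(V_2,E_2,g_2)$ is a pair of maps $\phi=(\phi_V:V_1\to V_2,\ \phi_E:E_1\to E_2)$ with $g_2\circ\phi_E=F(\phi_V)\circ g_1$. The category of $F$-graphs has these objects and morphisms. -}

module Defs where

open import Function using (_∘_; id)
open import Data.Product using (Σ; _×_; _,_; proj₁; proj₂)
open import Relation.Binary.PropositionalEquality using (_≡_; refl; sym)

-- A covariant endofunctor on Set (functor laws stated pointwise, since
-- function extensionality is not built into Agda; see the theorem statement).
record SetFunctor : Set₁ where
  field
    F₀     : Set → Set
    F₁     : {A B : Set} → (A → B) → F₀ A → F₀ B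
    F-id   : {A : Set} (x : F₀ A) → F₁ (λ (a : A) → a) x ≡ x
    F-∘    : {A B C : Set} (f : A → B) (g : B → C) (x : F₀ A) →
             F₁ (λ a → g (f a)) x ≡ F₁ g (F₁ f x)

module _ (F : SetFunctor) where
  open SetFunctor F

  record FGraph : Set₁ where
    constructor mkFGraph
    field
      V : Set
      E : Set
      g : E → F₀ V

  open FGraph

  record Hom (G H : FGraph) : Set where
    constructor mkHom
    field
      φV   : V G → V H
      φE   : E G → E H
      comm : (e : E G) → g H (φE e) ≡ F₁ φV (g G e)

  open Hom

  _∘Hom_ : {G H K : FGraph} → Hom H K → Hom G H → Hom G K
  _∘Hom_ {G} {H} {K} ψ φ = mkHom (φV ψ ∘ φV φ) (φE ψ ∘ φE φ) c
    where
    open Relation.Binary.PropositionalEquality using (trans; cong)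
    c : (e : E G) → g K (φE ψ (φE φ e)) ≡ F₁ (λ v → φV ψ (φV φ v)) (g G e)
    c e = trans (comm ψ (φE φ e))
           (trans (cong (F₁ (φV ψ)) (comm φ e)) (sym (F-∘ (φV φ) (φV ψ) (g G e))))

  _≈Hom_ : {G H : FGraph} → Hom G H → Hom G H → Set
  φ ≈Hom ψ = (∀ v → φV φ v ≡ φV ψ v) × (∀ e → φE φ e ≡ φE ψ e)

  IsProduct : {I : Set} (G : I → FGraph) (P : FGraph) (π : (i : I) → Hom P (G i)) → Set₁
  IsProduct {I} G P π =
    (W : FGraph) (ψ : (i : I) → Hom W (G i)) →
    Σ (Hom W P) λ u →
      ((i : I) → (π i ∘Hom u) ≈Hom ψ i) ×
      ((u' : Hom W P) → ((i : I) → (π i ∘Hom u') ≈Hom ψ i) → u' ≈Hom u)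

  module _ {I : Set} (G : I → FGraph) where

    ΠV : Set
    ΠV = (i : I) → V (G i)

    ΠE : Set
    ΠE = (i : I) → E (G i)

    ΠFV : Set
    ΠFV = (i : I) → F₀ (V (G i))

    α : ΠE → ΠFV
    α y i = g (G i) (y i)

    β : F₀ ΠV → ΠFV
    β x i = F₁ (λ (v : ΠV) → v i) x

    Eprod : Set
    Eprod = Σ (F₀ ΠV × ΠE) λ p → (i : I) → β (proj₁ p) i ≡ α (proj₂ p) i

    pbα : Eprod → F₀ ΠV
    pbα p = proj₁ (proj₁ p)

    pbβ : Eprod → ΠE
    pbβ p = proj₂ (proj₁ p)

    pb-square : (p : Eprod) (i : I) → β (pbα p) i ≡ α (pbβ p) i
    pb-square p = proj₂ p

    prodGraph : FGraph
    prodGraph = mkFGraph ΠV Eprod pbα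

    prodProj : (i : I) → Hom prodGraph (G i)
    prodProj i = mkHom (λ v → v i) (λ p → pbβ p i) (λ p → sym (pb-square p i))

-- A cone (ψ i : W → G i) determines its vertex map w ↦ (i ↦ ψ_i^V w) by the product
-- in Set; an edge e must then go to the pair (F(u^V)(g e), i ↦ ψ_i^E e), which lies in
-- the pullback because F(π_i) ∘ F(u^V) = F(ψ_i^V) and ψ_i is a homomorphism.
-- Uniqueness holds because an element of the pullback is determined by its pair:
-- the remaining component is a family of equality proofs, irrelevant by UIP.
module Submission where

open import Level using (0ℓ)
open import Axiom.Extensionality.Propositional using (Extensionality)
open import Axiom.UniquenessOfIdentityProofs.WithK using (uip)
open import Data.Product using (Σ; _,_; proj₁; proj₂)
open import Data.Product.Properties using (×-≡,≡→≡)
open import Relation.Binary.PropositionalEquality using (_≡_; refl; sym; trans; cong)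
open import Defs

module _ (ext : Extensionality 0ℓ 0ℓ) (F : SetFunctor) {I : Set} (G : I → FGraph F) where
  open SetFunctor F
  open FGraph
  open Hom

  Eprod-≡ : (x y : Eprod F G) → proj₁ x ≡ proj₁ y → x ≡ y
  Eprod-≡ (a , p) (.a , q) refl = cong (a ,_) (ext λ i → uip (p i) (q i))

  module _ {W : FGraph F} (ψ : (i : I) → Hom F W (G i)) where

    tupleV : V W → ΠV F G
    tupleV w i = φV (ψ i) w

    tuple-square : (e : E W) (i : I) →
                   β F G (F₁ tupleV (g W e)) i ≡ α F G (λ j → φE (ψ j) e) i
    tuple-square e i = trans (sym (F-∘ tupleV (λ v → v i) (g W e))) (sym (comm (ψ i) e))

    tupleE : E W → Eprod F G
    tupleE e = (F₁ tupleV (g W e) , λ j → φE (ψ j) e) , tuple-square e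

    tupleHom : Hom F W (prodGraph F G)
    tupleHom = mkHom tupleV tupleE (λ _ → refl)

    prodProj-∘-tupleHom : (i : I) → _≈Hom_ F (_∘Hom_ F (prodProj F G i) tupleHom) (ψ i)
    prodProj-∘-tupleHom i = (λ _ → refl) , (λ _ → refl)

    tupleHom-unique : (u : Hom F W (prodGraph F G)) →
                      ((i : I) → _≈Hom_ F (_∘Hom_ F (prodProj F G i) u) (ψ i)) →
                      _≈Hom_ F u tupleHom
    tupleHom-unique u factors = vertices-agree , edges-agree
      where
      vertices-agree : ∀ w → φV u w ≡ tupleV w
      vertices-agree w = ext λ i → proj₁ (factors i) w

      edges-agree : ∀ e → φE u e ≡ tupleE e
      edges-agree e = Eprod-≡ (φE u e) (tupleE e) (×-≡,≡→≡
        ( trans (comm u e) (cong (λ f → F₁ f (g W e)) (ext vertices-agree))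
        , ext λ i → proj₂ (factors i) e))

mainTheorem3 : Extensionality 0ℓ 0ℓ →
               (F : SetFunctor) (I : Set) (G : I → FGraph F) →
                 IsProduct F G (prodGraph F G) (prodProj F G)
mainTheorem3 ext F I G W ψ =
  tupleHom ext F G ψ , prodProj-∘-tupleHom ext F G ψ , tupleHom-unique ext F G ψ
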